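{- The mapping $\gamma\circ\delta$ is the identity mapping on tree-rooted maps; that is, for every tree-rooted map $M_T$, the procedure $\gamma$ applied to $\delta(M_T)$ returns $T$.
   Context: A (rooted planar) map is a 2-cell embedding of a connected planar graph (loops and multiple edges allowed) in the oriented sphere up to orientation-preserving homeomorphism, with a distinguished half-edge, the root; its incident vertex is the root-vertex. A tree-rooted map $M_T$ is a map $M$ with a distinguished spanning tree $T$. The tour of $T$ follows its border counterclockwise from the root back to the root, inducing a linear order ("precedes around $T$") on half-edges not in $T$. In an oriented map each edge goes from origin (tail) to end (head); the root is considered a head. $\delta(M_T)$ orients edges of $T$ away from the root-vertex and each edge not in $T$ so that its head precedes its tail around $T$. Procedure $\gamma$ on an oriented map: start with $T'$ consisting of the root and the root-vertex; make the tour of $T'$ starting from the root, and whenever the tail of an edge $e$ is encountered while its head has not been encountered yet, add $e$ (with its end) to $T'$; continue the tour (following $e$'s border if $e\in T'$, crossing $e$ otherwise); stop at the root and return $T'$. -}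

module Defs where

open import Data.Nat using (ℕ; zero; suc; _+_; _*_; _≤_; _≤ᵇ_)
open import Data.Bool using (Bool; true; false; if_then_else_; not; _∧_)
open import Data.Fin using (Fin; toℕ; _≟_)
open import Data.Fin.Permutation using (Permutation′; _⟨$⟩ʳ_)
open import Data.List using (List; upTo; map)
open import Data.Nat.ListAction using (sum)
open import Data.List.Base using () renaming (tabulate to ltabulate)
open import Data.Maybe using (Maybe; just; nothing)
open import Data.Product using (Σ; _×_; _,_)
open import Data.Sum using (_⊎_)
open import Relation.Nullary using (¬_)
open import Relation.Nullary.Decidable using (⌊_⌋)
open import Relation.Binary.PropositionalEquality using (_≡_)
open import Relation.Binary.Construct.Closure.ReflexiveTransitive using (Star)

iter : ∀ {m} → (Fin m → Fin m) → ℕ → Fin m → Fin m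
iter f zero    h = h
iter f (suc k) h = f (iter f k h)

allB : ∀ {A : Set} → (A → Bool) → List A → Bool
allB p List.[]       = true
allB p (x List.∷ xs) = p x ∧ allB p xs

isOrbitMin : ∀ {m} → (Fin m → Fin m) → Fin m → Bool
isOrbitMin {m} f h = allB (λ k → toℕ h ≤ᵇ toℕ (iter f k h)) (upTo m)

countTrue : ∀ {m} → (Fin m → Bool) → ℕ
countTrue {m} p = sum (ltabulate {n = m} (λ h → if p h then 1 else 0))

cycles : ∀ {m} → (Fin m → Fin m) → ℕ
cycles f = countTrue (isOrbitMin f)

update : ∀ {m} → (Fin m → Bool) → Fin m → Bool → (Fin m → Bool)
update p x b y = if ⌊ y ≟ x ⌋ then b else p y

-- Half-edges: Fin m.  σ: counterclockwise rotation of half-edges around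
-- their vertex.  α: the edge involution.  The root is a dangling
-- half-edge (a "leg", the unique fixed point of α) sitting in a corner of
-- the root-vertex; it belongs to no edge.  Vertices = cycles of σ,
-- faces = cycles of σ∘α, edges = (m - 1)/2.

record RootedMap (m : ℕ) : Set where
  field
    σ α       : Permutation′ m
    root      : Fin m
    α-invol   : ∀ h → α ⟨$⟩ʳ (α ⟨$⟩ʳ h) ≡ h
    α-root    : α ⟨$⟩ʳ root ≡ root
    α-fix     : ∀ h → α ⟨$⟩ʳ h ≡ h → h ≡ root
    connected : ∀ h → Star (λ x y → y ≡ σ ⟨$⟩ʳ x ⊎ y ≡ α ⟨$⟩ʳ x) root h
    -- planarity (genus 0): Euler's formula V - E + F = 2, with m = 2E + 1,
    -- V = #cycles of σ, F = #cycles of σ∘α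
    planar    : 2 * (cycles (σ ⟨$⟩ʳ_) + cycles (λ h → σ ⟨$⟩ʳ (α ⟨$⟩ʳ h))) ≡ m + 3

open RootedMap public

σf αf : ∀ {m} → RootedMap m → Fin m → Fin m
σf M h = σ M ⟨$⟩ʳ h
αf M h = α M ⟨$⟩ʳ h

V : ∀ {m} → RootedMap m → ℕ
V M = cycles (σf M)

-- Spanning trees, given as the set of their half-edges (closed under α).
-- A spanning tree = a connected spanning subgraph with V - 1 edges.

record SpanningTree {m} (M : RootedMap m) : Set where
  field
    inT       : Fin m → Bool
    inT-root  : inT (root M) ≡ false
    inT-α     : ∀ h → inT (αf M h) ≡ inT h
    spanning  : ∀ h → Star (λ x y → y ≡ σf M x ⊎ (inT x ≡ true × y ≡ αf M x)) (root M) h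
    edgeCount : countTrue inT + 2 ≡ 2 * V M

open SpanningTree public

-- The tour of T: from half-edge h, if h ∈ T follow the border of its edge
-- (arrive at α h and turn to the next half-edge counterclockwise),
-- otherwise cross the edge (turn directly to the next half-edge).
tourStep : ∀ {m} (M : RootedMap m) → (Fin m → Bool) → Fin m → Fin m
tourStep M t h = if t h then σf M (αf M h) else σf M h

Precedes : ∀ {m} (M : RootedMap m) (T : SpanningTree M) → Fin m → Fin m → Set
Precedes M T h h' =
  Σ ℕ λ k → (iter (tourStep M (inT T)) k (root M) ≡ h)
          × (∀ j → j ≤ k → ¬ (iter (tourStep M (inT T)) j (root M) ≡ h'))

-- Orientations: head h = true iff h is the head-half-edge of its edge.
-- The root is considered a head.

record Orientation {m} (M : RootedMap m) : Set where
  field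
    head      : Fin m → Bool
    head-root : head (root M) ≡ true
    head-α    : ∀ h → ¬ (h ≡ root M) → head (αf M h) ≡ not (head h)

open Orientation public

-- O is δ(M_T): edges of T oriented away from the root-vertex (every
-- half-edge is reachable from the root moving around vertices and along
-- tree edges from tail to head), and each edge not in T oriented so that
-- its head precedes its tail around T.
record IsDelta {m} (M : RootedMap m) (T : SpanningTree M) (O : Orientation M) : Set where
  field
    tree-away : ∀ h → Star (λ x y → y ≡ σf M x ⊎ (inT T x ≡ true × head O x ≡ false × y ≡ αf M x)) (root M) h
    nontree   : ∀ h → ¬ (h ≡ root M) → inT T h ≡ false →
                (head O h ≡ true → Precedes M T h (αf M h))
              × (Precedes M T h (αf M h) → head O h ≡ true)

-- Procedure γ on an oriented map.
-- State: current half-edge, current T' (set of half-edges, root included),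
-- set of half-edges already encountered.

record GState (m : ℕ) : Set where
  constructor gstate
  field
    cur : Fin m
    tr  : Fin m → Bool
    enc : Fin m → Bool

γstep : ∀ {m} (M : RootedMap m) (O : Orientation M) → GState m → GState m
γstep M O (gstate h t e) =
  let e'  = update e h true
      add = not (head O h) ∧ not (e (αf M h))   -- tail met, head not yet met
      t'  = if add then update (update t h true) (αf M h) true else t
      nxt = if t' h then σf M (αf M h) else σf M h
  in gstate nxt t' e'

γrun : ∀ {m} (M : RootedMap m) (O : Orientation M) → ℕ → GState m → Maybe (Fin m → Bool)
γrun M O zero    s = nothing
γrun M O (suc n) s with γstep M O s
... | s' = if ⌊ GState.cur s' ≟ root M ⌋ then just (GState.tr s') else γrun M O n s'

-- γ: tour starting from the root with T' = {root}; stop when back at the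
-- root.  (Fuel m: a tour meets each of the m half-edges once; `nothing`
-- means the tour did not return to the root.)
γ : ∀ {m} (M : RootedMap m) (O : Orientation M) → Maybe (Fin m → Bool)
γ {m} M O = γrun M O m (gstate (root M) (λ h → ⌊ h ≟ root M ⌋) (λ _ → false))

{-# OPTIONS --safe #-}
-- The tour of T (tourStep M (inT T) iterated from the root) is a single cycle through all
-- half-edges in which the tail of every edge of T comes before its head. To see this, grow T
-- from the empty subtree, each time attaching an edge of T whose tail is already on the tour:
-- the new tour is the old one with the whole rotation around the new vertex spliced in right
-- after that tail. As T is oriented away from the root, the growth stops only at a subtree
-- whose tour meets every vertex, and counting (2E + 2 = 2V) shows that this subtree is T.
--
-- On δ(M_T), procedure γ walks exactly this tour: at the tail of a tree edge the head has not
-- been encountered yet, so γ adds the edge; at the tail of a non-tree edge the head precedes it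
-- around T, so nothing is added; and a tree edge reached at its head was added at its tail.
-- Hence γ is back at the root after one full tour, with T' = T.
module Submission where

open import Defs
import Data.Bool as Bool
open import Data.Bool using (Bool; true; false; if_then_else_; not; _∧_)
open import Data.Bool.Properties using (T-≡; ∧-zeroʳ; ∧-identityʳ)
open import Data.Empty using (⊥; ⊥-elim)
open import Data.Fin as Fin using (Fin; toℕ; _≟_)
open import Data.Fin.Permutation using (_⟨$⟩ˡ_; inverseˡ)
open import Data.Fin.Properties
  using (toℕ-injective; toℕ<n; toℕ-fromℕ<; toℕ-inject; pigeonhole; injective⇒≤; any?; ¬∀⟶∃¬-smallest)
import Data.Fin.Properties as Finₚ
open import Data.List using ([]; _∷_; upTo)
open import Data.List.Membership.Propositional using (_∈_)
open import Data.List.Membership.Propositional.Properties using (∈-upTo⁺)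
open import Data.List.Relation.Unary.Any using (here; there)
open import Data.Maybe using (just)
open import Data.Nat as ℕ using (ℕ; zero; suc; _+_; _*_; _∸_; _≤_; _<_; _≮_; _≤ᵇ_; z≤n; s≤s; NonZero; >-nonZero)
open import Data.Nat.DivMod using (_%_; _/_; m≡m%n+[m/n]*n; m%n<n; m%n≤m)
open import Data.Nat.Properties hiding (_≟_)
open import Data.Product using (Σ; _×_; _,_; proj₁; proj₂)
open import Data.Sum using (_⊎_; inj₁; inj₂; [_,_]′; map₂)
open import Function using (_∘_)
open import Function.Bundles using (Equivalence)
open import Function.Definitions using (Injective)
open import Relation.Binary.Construct.Closure.ReflexiveTransitive using (fold)
open import Relation.Binary.Definitions using (tri<; tri≈; tri>)
open import Relation.Binary.PropositionalEquality
open import Relation.Nullary using (¬_; Dec; yes; no; ¬?; _×-dec_; contradiction)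
open import Relation.Nullary.Decidable using (⌊_⌋; map′; decidable-stable)
open import Relation.Unary using (Decidable)

≤ᵇ-true⇒≤ : ∀ {a b} → (a ≤ᵇ b) ≡ true → a ≤ b
≤ᵇ-true⇒≤ {a} {b} e = ≤ᵇ⇒≤ a b (Equivalence.from T-≡ e)

≤⇒≤ᵇ-true : ∀ {a b} → a ≤ b → (a ≤ᵇ b) ≡ true
≤⇒≤ᵇ-true a≤b = Equivalence.to T-≡ (≤⇒≤ᵇ a≤b)

isYes-true : ∀ {A : Set} (A? : Dec A) → A → ⌊ A? ⌋ ≡ true
isYes-true (yes _) _ = refl
isYes-true (no ¬a) a = ⊥-elim (¬a a)

isYes-false : ∀ {A : Set} (A? : Dec A) → ¬ A → ⌊ A? ⌋ ≡ false
isYes-false (yes a) ¬a = ⊥-elim (¬a a)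
isYes-false (no _)  _  = refl

isYes-cong : ∀ {A B : Set} (A? : Dec A) (B? : Dec B) → (A → B) → (B → A) → ⌊ A? ⌋ ≡ ⌊ B? ⌋
isYes-cong (yes _) (yes _)  _   _   = refl
isYes-cong (no _)  (no _)   _   _   = refl
isYes-cong (yes a) (no ¬b)  A→B _   = ⊥-elim (¬b (A→B a))
isYes-cong (no ¬a) (yes b)  _   B→A = ⊥-elim (¬a (B→A b))

allB-∈ : ∀ {A : Set} {p : A → Bool} {xs x} → allB p xs ≡ true → x ∈ xs → p x ≡ true
allB-∈ {p = p} {y ∷ _} all∈ x∈ with p y in py
allB-∈ {p = p} {y ∷ _} all∈ (here refl) | true = py
allB-∈ {p = p} {y ∷ _} all∈ (there x∈) | true = allB-∈ all∈ x∈

allB-intro : ∀ {A : Set} {p : A → Bool} xs → (∀ x → p x ≡ true) → allB p xs ≡ true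
allB-intro []       _  = refl
allB-intro (x ∷ xs) px rewrite px x = allB-intro xs px

update-≡ : ∀ {m} (p : Fin m → Bool) x b → update p x b x ≡ b
update-≡ p x b with x ≟ x
... | yes _   = refl
... | no x≢x = ⊥-elim (x≢x refl)

update-≢ : ∀ {m} (p : Fin m → Bool) {x y} b → y ≢ x → update p x b y ≡ p y
update-≢ p {x} {y} b y≢x with y ≟ x
... | yes y≡x = ⊥-elim (y≢x y≡x)
... | no _    = refl

module _ {m} (f : Fin m → Fin m) where

  iter-+ : ∀ j k h → iter f (j + k) h ≡ iter f j (iter f k h)
  iter-+ zero    k h = refl
  iter-+ (suc j) k h = cong f (iter-+ j k h)

  iter-*-returns : ∀ {n y} → iter f n y ≡ y → ∀ q → iter f (q * n) y ≡ y
  iter-*-returns ret zero = refl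
  iter-*-returns {n} {y} ret (suc q) =
    trans (iter-+ n (q * n) y) (trans (cong (iter f n) (iter-*-returns ret q)) ret)

  iter-% : ∀ {n y} .{{_ : NonZero n}} → iter f n y ≡ y → ∀ k → iter f (k % n) y ≡ iter f k y
  iter-% {n} {y} ret k = begin
    iter f (k % n) y                      ≡⟨ cong (iter f (k % n)) (iter-*-returns ret (k / n)) ⟨
    iter f (k % n) (iter f (k / n * n) y) ≡⟨ iter-+ (k % n) (k / n * n) y ⟨
    iter f (k % n + k / n * n) y          ≡⟨ cong (λ i → iter f i y) (m≡m%n+[m/n]*n k n) ⟨
    iter f k y                            ∎
    where open ≡-Reasoning

iter-cong : ∀ {m} {f g : Fin m → Fin m} {y} → (∀ k → f (iter f k y) ≡ g (iter f k y)) →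
            ∀ k → iter f k y ≡ iter g k y
iter-cong         e zero    = refl
iter-cong {g = g} e (suc k) = trans (e k) (cong g (iter-cong e k))

Reach : ∀ {m} → (Fin m → Fin m) → Fin m → Fin m → Set
Reach f y h = Σ ℕ λ k → iter f k y ≡ h

-- Defs.Precedes M T is Before (tourStep M (inT T)) (root M).
Before : ∀ {m} → (Fin m → Fin m) → Fin m → Fin m → Fin m → Set
Before f r u v = Σ ℕ λ k → iter f k r ≡ u × (∀ j → j ≤ k → ¬ iter f j r ≡ v)

reach-step : ∀ {m} {f : Fin m → Fin m} {y h} → Reach f y h → Reach f y (f h)
reach-step (k , e) = suc k , cong _ e

reach-trans : ∀ {m} {f : Fin m → Fin m} {y h z} → Reach f y h → Reach f h z → Reach f y z
reach-trans {f = f} {y} (k , refl) (l , refl) = l + k , iter-+ f l k y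

least : ∀ {P : ℕ → Set} → Decidable P → ∀ {n} → P n →
        Σ ℕ λ k → P k × k ≤ n × (∀ j → j < k → ¬ P j)
least P? {n} pn with P? 0
... | yes p0 = 0 , p0 , z≤n , λ _ ()
least P? {zero}  pn | no ¬p0 = ⊥-elim (¬p0 pn)
least {P} P? {suc n} pn | no ¬p0 with least (λ k → P? (suc k)) pn
... | k , pk , k≤n , below = suc k , pk , s≤s k≤n , below′
  where
    below′ : ∀ j → j < suc k → ¬ P j
    below′ zero    _         = ¬p0
    below′ (suc j) (s≤s j<k) = below j j<k

bit : Bool → ℕ
bit b = if b then 1 else 0

countTrue-cong : ∀ {m} {p q : Fin m → Bool} → (∀ h → p h ≡ q h) → countTrue p ≡ countTrue q
countTrue-cong {zero}  _   = refl
countTrue-cong {suc m} p≗q = cong₂ _+_ (cong bit (p≗q Fin.zero)) (countTrue-cong (λ h → p≗q (Fin.suc h)))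

countTrue-false : ∀ {m} {p : Fin m → Bool} → (∀ h → p h ≡ false) → countTrue p ≡ 0
countTrue-false {zero}  _     = refl
countTrue-false {suc m} p≡ff rewrite p≡ff Fin.zero = countTrue-false (λ h → p≡ff (Fin.suc h))

countTrue-insert : ∀ {m} {p q : Fin m → Bool} a → p a ≡ false → q a ≡ true →
                   (∀ h → h ≢ a → p h ≡ q h) → countTrue q ≡ suc (countTrue p)
countTrue-insert {suc m} Fin.zero pa qa p≗q rewrite pa | qa =
  cong suc (countTrue-cong (λ h → sym (p≗q (Fin.suc h) λ ())))
countTrue-insert {suc m} {p} {q} (Fin.suc a) pa qa p≗q rewrite p≗q Fin.zero (λ ()) =
  trans (cong (bit (q Fin.zero) +_)
              (countTrue-insert a pa qa (λ h h≢a → p≗q (Fin.suc h) (h≢a ∘ Finₚ.suc-injective))))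
        (+-suc (bit (q Fin.zero)) _)

bit-mono : ∀ {a b} → (a ≡ true → b ≡ true) → bit a ≤ bit b
bit-mono {false} _   = z≤n
bit-mono {true}  a⇒b rewrite a⇒b refl = ≤-refl

bit-injective : ∀ {a b} → bit a ≡ bit b → a ≡ b
bit-injective {false} {false} _ = refl
bit-injective {true}  {true}  _ = refl

+-≤-≡⇒≡ˡ : ∀ {a b c d} → a ≤ c → b ≤ d → a + b ≡ c + d → a ≡ c
+-≤-≡⇒≡ˡ a≤c b≤d e with m≤n⇒m<n∨m≡n a≤c
... | inj₁ a<c = ⊥-elim (<⇒≢ (+-mono-<-≤ a<c b≤d) e)
... | inj₂ a≡c = a≡c

countTrue-mono : ∀ {m} {p q : Fin m → Bool} → (∀ h → p h ≡ true → q h ≡ true) →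
                 countTrue p ≤ countTrue q
countTrue-mono {zero}  _   = z≤n
countTrue-mono {suc m} p⊆q = +-mono-≤ (bit-mono (p⊆q Fin.zero)) (countTrue-mono (p⊆q ∘ Fin.suc))

countTrue-⊆-≡ : ∀ {m} {p q : Fin m → Bool} → (∀ h → p h ≡ true → q h ≡ true) →
                countTrue p ≡ countTrue q → ∀ h → p h ≡ q h
countTrue-⊆-≡ {suc m} {p} {q} p⊆q e h
  with +-≤-≡⇒≡ˡ (bit-mono (p⊆q Fin.zero)) (countTrue-mono (p⊆q ∘ Fin.suc)) e
countTrue-⊆-≡ {suc m} {p} {q} p⊆q e Fin.zero    | e₀ = bit-injective e₀
countTrue-⊆-≡ {suc m} {p} {q} p⊆q e (Fin.suc h) | e₀ =
  countTrue-⊆-≡ (p⊆q ∘ Fin.suc) (+-cancelˡ-≡ (bit (p Fin.zero)) _ _ (trans e (cong (_+ _) (sym e₀)))) h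

module Cycles {m} {f : Fin m → Fin m} (f-inj : Injective _≡_ _≡_ f) where

  iter-injective : ∀ k → Injective _≡_ _≡_ (iter f k)
  iter-injective zero    e = e
  iter-injective (suc k) e = iter-injective k (f-inj e)

  return-gap : ∀ {y i j} → i < j → iter f i y ≡ iter f j y → iter f (j ∸ i) y ≡ y
  return-gap {y} {i} {j} i<j e = sym (iter-injective i (begin
    iter f i y                   ≡⟨ e ⟩
    iter f j y                   ≡⟨ cong (λ k → iter f k y) (m+[n∸m]≡n (<⇒≤ i<j)) ⟨
    iter f (i + (j ∸ i)) y       ≡⟨ iter-+ f i (j ∸ i) y ⟩
    iter f i (iter f (j ∸ i) y)  ∎))
    where open ≡-Reasoning

  record Cycle (y : Fin m) : Set where
    field
      length   : ℕ
      length>0 : 0 < length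
      returns  : iter f length y ≡ y
      minimal  : ∀ k → 0 < k → k < length → iter f k y ≢ y

  cycle-from-return : ∀ {y} n → 0 < n → iter f n y ≡ y → Cycle y
  cycle-from-return {y} (suc n) _ ret with least (λ k → iter f (suc k) y ≟ y) {n} ret
  ... | k , ret′ , _ , below = record
    { length = suc k ; length>0 = s≤s z≤n ; returns = ret′ ; minimal = minimal′ }
    where
      minimal′ : ∀ j → 0 < j → j < suc k → iter f j y ≢ y
      minimal′ (suc j) _ (s≤s j<k) = below j j<k

  opaque
    cycle : ∀ y → Cycle y
    cycle y with pigeonhole (n<1+n m) (λ (i : Fin (suc m)) → iter f (toℕ i) y)
    ... | i , j , i<j , e = cycle-from-return (toℕ j ∸ toℕ i) (m<n⇒0<n∸m i<j) (return-gap i<j e)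

  module CycleProperties {y} (C : Cycle y) where
    open Cycle C

    private instance
      length-nonZero : NonZero length
      length-nonZero = >-nonZero length>0

    distinct : ∀ {i j} → i < length → j < length → iter f i y ≡ iter f j y → i ≡ j
    distinct {i} {j} i<l j<l e with <-cmp i j
    ... | tri≈ _ i≡j _ = i≡j
    ... | tri< i<j _ _ =
      ⊥-elim (minimal (j ∸ i) (m<n⇒0<n∸m i<j) (≤-<-trans (m∸n≤m j i) j<l) (return-gap i<j e))
    ... | tri> _ _ j<i =
      ⊥-elim (minimal (i ∸ j) (m<n⇒0<n∸m j<i) (≤-<-trans (m∸n≤m i j) i<l) (return-gap j<i (sym e)))

    within : ∀ {h} → Reach f y h → Σ ℕ λ i → i < length × iter f i y ≡ h
    within (k , refl) = k % length , m%n<n k length , iter-% f returns k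

    before-within : ∀ {u v} → Before f y u v →
                    Σ ℕ λ k → k < length × iter f k y ≡ u × (∀ j → j ≤ k → iter f j y ≢ v)
    before-within (k , refl , v-later) =
      k % length , m%n<n k length , iter-% f returns k ,
      λ j j≤ → v-later j (≤-trans j≤ (m%n≤m k length))

    length≤m : length ≤ m
    length≤m = injective⇒≤ {f = λ (i : Fin length) → iter f (toℕ i) y}
                 (λ e → toℕ-injective (distinct (toℕ<n _) (toℕ<n _) e))

  open CycleProperties

  reach-sym : ∀ {y h} → Reach f y h → Reach f h y
  reach-sym {y} r with within (cycle y) r
  ... | i , i<l , refl = length ∸ i , (begin
    iter f (length ∸ i) (iter f i y) ≡⟨ iter-+ f (length ∸ i) i y ⟨
    iter f (length ∸ i + i) y        ≡⟨ cong (λ k → iter f k y) (m∸n+n≡m (<⇒≤ i<l)) ⟩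
    iter f length y                  ≡⟨ returns ⟩
    y                                ∎)
    where open ≡-Reasoning
          open Cycle (cycle y)

  reach? : ∀ y → Decidable (Reach f y)
  reach? y h = map′ (λ (i , e) → toℕ i , e) into
                    (any? (λ (i : Fin (Cycle.length (cycle y))) → iter f (toℕ i) y ≟ h))
    where
      into : Reach f y h → Σ (Fin (Cycle.length (cycle y))) λ i → iter f (toℕ i) y ≡ h
      into r with within (cycle y) r
      ... | i , i<l , e = Fin.fromℕ< i<l , subst (λ k → iter f k y ≡ h) (sym (toℕ-fromℕ< i<l)) e

  orbitMin-≤ : ∀ {h z} → isOrbitMin f h ≡ true → Reach f h z → toℕ h ≤ toℕ z
  orbitMin-≤ {h} min r with within (cycle h) r
  ... | i , i<l , refl =
    ≤ᵇ-true⇒≤ (allB-∈ min (∈-upTo⁺ (<-≤-trans i<l (length≤m (cycle h)))))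

  orbitMin-unique : ∀ {y h h′} → Reach f y h → Reach f y h′ →
                    isOrbitMin f h ≡ true → isOrbitMin f h′ ≡ true → h ≡ h′
  orbitMin-unique yh yh′ min min′ = toℕ-injective (≤-antisym
    (orbitMin-≤ min  (reach-trans (reach-sym yh)  yh′))
    (orbitMin-≤ min′ (reach-trans (reach-sym yh′) yh)))

  opaque
    orbitMin-exists : ∀ y → Σ (Fin m) λ h → Reach f y h × isOrbitMin f h ≡ true
    orbitMin-exists y
      with ¬∀⟶∃¬-smallest m (λ h → ¬ Reach f y h) (λ h → ¬? (reach? y h)) (λ none → none y (0 , refl))
    ... | h , ¬¬yh , smaller = h , yh , allB-intro (upTo m) (λ k → ≤⇒≤ᵇ-true (≮⇒≥ (h-min k)))
      where
        yh : Reach f y h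
        yh = decidable-stable (reach? y h) ¬¬yh
        h-min : ∀ k → toℕ (iter f k h) ≮ toℕ h
        h-min k lt = smaller (Fin.fromℕ< lt)
          (subst (Reach f y) (sym (toℕ-injective (trans (toℕ-inject _) (toℕ-fromℕ< lt))))
                 (reach-trans yh (k , refl)))

  cyclesMeeting : (S : Fin m → Set) → Decidable S → ℕ
  cyclesMeeting S S? = countTrue (λ h → isOrbitMin f h ∧ ⌊ S? h ⌋)

  cyclesMeeting-∅ : ∀ {S} (S? : Decidable S) → (∀ h → ¬ S h) → cyclesMeeting S S? ≡ 0
  cyclesMeeting-∅ S? none = countTrue-false (λ h →
    trans (cong (isOrbitMin f h ∧_) (isYes-false (S? h) (none h))) (∧-zeroʳ _))

  cyclesMeeting-all : ∀ {S} (S? : Decidable S) → (∀ h → S h) → cyclesMeeting S S? ≡ cycles f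
  cyclesMeeting-all S? all = countTrue-cong (λ h →
    trans (cong (isOrbitMin f h ∧_) (isYes-true (S? h) (all h))) (∧-identityʳ _))

  cyclesMeeting-∪ : ∀ {S S′ : Fin m → Set} (S? : Decidable S) (S′? : Decidable S′) y →
                    (∀ h → S′ h → S h ⊎ Reach f y h) → (∀ h → S h → S′ h) →
                    (∀ h → Reach f y h → S′ h) → (∀ h → Reach f y h → ¬ S h) →
                    cyclesMeeting S′ S′? ≡ suc (cyclesMeeting S S?)
  cyclesMeeting-∪ {S} S? S′? y S′⊆ S⊆S′ y⊆S′ disjoint with orbitMin-exists y
  ... | h* , yh* , min* =
    countTrue-insert {p = λ h → isOrbitMin f h ∧ ⌊ S? h ⌋} {q = λ h → isOrbitMin f h ∧ ⌊ S′? h ⌋} h*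
    (trans (cong (_∧ ⌊ S? h* ⌋) min*) (isYes-false (S? h*) (disjoint h* yh*)))
    (trans (cong (_∧ ⌊ S′? h* ⌋) min*) (isYes-true (S′? h*) (y⊆S′ h* yh*)))
    same
    where
      same : ∀ h → h ≢ h* → isOrbitMin f h ∧ ⌊ S? h ⌋ ≡ isOrbitMin f h ∧ ⌊ S′? h ⌋
      same h h≢h* with isOrbitMin f h in min
      ... | false = refl
      ... | true  = isYes-cong (S? h) (S′? h) (S⊆S′ h) (λ s′ →
        [ (λ s → s) , (λ yh → ⊥-elim (h≢h* (orbitMin-unique yh yh* min min*))) ]′ (S′⊆ h s′))

  -- Composing f with the transposition of x and y merges their cycles: the iterates of g from r
  -- are those of f up to x, then the whole cycle of y, then the rest of the cycle of r.
  module Merge {g : Fin m → Fin m} {r x y : Fin m}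
               (g-x : g x ≡ f y) (g-y : g y ≡ f x) (g-f : ∀ h → h ≢ x → h ≢ y → g h ≡ f h)
               (r↝x : Reach f r x) (disjoint : ∀ i j → iter f i r ≢ iter f j y) where

    private
      R Y : Cycle _
      R = cycle r
      Y = cycle y
      p c a : ℕ
      p = Cycle.length R
      c = Cycle.length Y
      a = proj₁ (within R r↝x)
      a<p : a < p
      a<p = proj₁ (proj₂ (within R r↝x))
      fa : iter f a r ≡ x
      fa = proj₂ (proj₂ (within R r↝x))

    prefix : ∀ k → k ≤ a → iter g k r ≡ iter f k r
    prefix zero    _    = refl
    prefix (suc k) k<a = trans (cong g (prefix k (<⇒≤ k<a))) (g-f _ ≢x (λ e → disjoint k 0 e))
      where
        ≢x : iter f k r ≢ x
        ≢x e = <⇒≢ k<a (distinct R (<-trans k<a a<p) a<p (trans e (sym fa)))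

    inserted : ∀ d → d < c → iter g (suc d + a) r ≡ iter f (suc d) y
    inserted zero    _     = trans (cong g (trans (prefix a ≤-refl) fa)) g-x
    inserted (suc d) sd<c  = trans (cong g (inserted d (<⇒≤ sd<c))) (g-f _ ≢x ≢y)
      where
        ≢x : iter f (suc d) y ≢ x
        ≢x e = disjoint a (suc d) (trans fa (sym e))
        ≢y : iter f (suc d) y ≢ y
        ≢y = Cycle.minimal Y (suc d) (s≤s z≤n) sd<c

    at-y : iter g (c + a) r ≡ y
    at-y = last c (Cycle.length>0 Y) (Cycle.returns Y) inserted
      where
        last : ∀ n → 0 < n → iter f n y ≡ y →
               (∀ d → d < n → iter g (suc d + a) r ≡ iter f (suc d) y) → iter g (n + a) r ≡ y
        last (suc n) _ ret ins = trans (ins n ≤-refl) ret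

    shifted : ∀ k → a < k → k ≤ p → iter g (c + k) r ≡ iter f k r
    shifted (suc k) (s≤s a≤k) k<p with m≤n⇒m<n∨m≡n a≤k
    ... | inj₂ refl = begin
      iter g (c + suc a) r  ≡⟨ cong (λ n → iter g n r) (+-suc c a) ⟩
      g (iter g (c + a) r)  ≡⟨ cong g at-y ⟩
      g y                   ≡⟨ g-y ⟩
      f x                   ≡⟨ cong f fa ⟨
      iter f (suc a) r      ∎
      where open ≡-Reasoning
    ... | inj₁ a<k = begin
      iter g (c + suc k) r  ≡⟨ cong (λ n → iter g n r) (+-suc c k) ⟩
      g (iter g (c + k) r)  ≡⟨ cong g (shifted k a<k (<⇒≤ k<p)) ⟩
      g (iter f k r)        ≡⟨ g-f _ ≢x (λ e → disjoint k 0 e) ⟩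
      iter f (suc k) r      ∎
      where
        open ≡-Reasoning
        ≢x : iter f k r ≢ x
        ≢x e = <⇒≢ a<k (sym (distinct R k<p a<p (trans e (sym fa))))

    private
      above-a : ∀ {j} → a < j → Σ ℕ λ d → suc d + a ≡ j
      above-a {j} a<j = j ∸ suc a , trans (sym (+-suc (j ∸ suc a) a)) (m∸n+n≡m a<j)

    classify : ∀ {j k} → a < k → k ≤ p → j ≤ c + k →
               Reach f y (iter g j r) ⊎ Σ ℕ λ i → i ≤ k × iter g j r ≡ iter f i r
    classify {j} {k} a<k k≤p j≤c+k with j ≤? a
    ... | yes j≤a = inj₂ (j , ≤-trans j≤a (<⇒≤ a<k) , prefix j j≤a)
    ... | no j≰a with above-a (≰⇒> j≰a)
    ...   | d , refl with d <? c
    ...     | yes d<c = inj₁ (suc d , sym (inserted d d<c))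
    ...     | no d≮c with d ∸ c | m∸n+n≡m (≮⇒≥ d≮c)
    ...       | e | refl = inj₂ (suc e + a , +-cancelˡ-≤ c _ _ (subst (_≤ c + k) (sym j≡) j≤c+k) ,
                                 trans (cong (λ n → iter g n r) (sym j≡)) (shifted (suc e + a) (s≤s (m≤n+m a e)) i≤p))
      where
        j≡ : c + (suc e + a) ≡ suc (e + c) + a
        j≡ = trans (sym (+-assoc c (suc e) a)) (cong (_+ a) (+-comm c (suc e)))
        i≤p : suc e + a ≤ p
        i≤p = ≤-trans (+-cancelˡ-≤ c _ _ (subst (_≤ c + k) (sym j≡) j≤c+k)) k≤p

    x-before-y : Before g r x y
    x-before-y = a , trans (prefix a ≤-refl) fa ,
                 λ j j≤a e → disjoint j 0 (trans (sym (prefix j j≤a)) e)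

    reach-merged⁻ : ∀ {h} → Reach f r h ⊎ Reach f y h → Reach g r h
    reach-merged⁻ (inj₁ r↝h) with within R r↝h
    ... | i , i<p , refl with i ≤? a
    ...   | yes i≤a = i , prefix i i≤a
    ...   | no i≰a  = c + i , shifted i (≰⇒> i≰a) (<⇒≤ i<p)
    reach-merged⁻ (inj₂ y↝h) with within Y y↝h
    ... | zero  , _   , refl = c + a , at-y
    ... | suc d , d<c , refl = suc d + a , inserted d (<⇒≤ d<c)

    before-merged : ∀ {u v} → Before f r u v → ¬ Reach f y v → Before g r u v
    before-merged b ¬y↝v with before-within R b
    ... | k , k<p , refl , v-later with k ≤? a
    ...   | yes k≤a = k , prefix k k≤a ,
            λ j j≤k e → v-later j j≤k (trans (sym (prefix j (≤-trans j≤k k≤a))) e)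
    ...   | no k≰a = c + k , shifted k (≰⇒> k≰a) (<⇒≤ k<p) , λ j j≤ e →
            [ (λ y↝ → ¬y↝v (subst (Reach f y) e y↝))
            , (λ (i , i≤k , e′) → v-later i i≤k (trans (sym e′) e)) ]′
            (classify (≰⇒> k≰a) (<⇒≤ k<p) j≤)

    private
      c+p-nonZero : NonZero (c + p)
      c+p-nonZero = >-nonZero (<-≤-trans (Cycle.length>0 R) (m≤n+m p c))
      g-returns : iter g (c + p) r ≡ r
      g-returns = trans (shifted p a<p ≤-refl) (Cycle.returns R)

    reach-merged : ∀ {h} → Reach g r h → Reach f r h ⊎ Reach f y h
    reach-merged (j , refl) with classify a<p ≤-refl (<⇒≤ (m%n<n j (c + p) ⦃ c+p-nonZero ⦄))
    ... | inj₁ y↝       = inj₂ (subst (Reach f y) (iter-% g ⦃ c+p-nonZero ⦄ g-returns j) y↝)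
    ... | inj₂ (i , _ , e) = inj₁ (i , trans (sym e) (iter-% g ⦃ c+p-nonZero ⦄ g-returns j))

module Tours {m} (M : RootedMap m) where

  α-involutive : ∀ h → αf M (αf M h) ≡ h
  α-involutive = α-invol M

  α-injective : Injective _≡_ _≡_ (αf M)
  α-injective {a} {b} e = trans (sym (α-involutive a)) (trans (cong (αf M) e) (α-involutive b))

  σ-injective : Injective _≡_ _≡_ (σf M)
  σ-injective e = trans (sym (inverseˡ (σ M))) (trans (cong (σ M ⟨$⟩ˡ_) e) (inverseˡ (σ M)))

  AlphaClosed : (Fin m → Bool) → Set
  AlphaClosed t = ∀ h → t (αf M h) ≡ t h

  tourStep-root : ∀ t → tourStep M t (root M) ≡ σf M (root M)
  tourStep-root t with t (root M)
  ... | true  = cong (σf M) (α-root M)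
  ... | false = refl

  private
    turn : (Fin m → Bool) → Fin m → Fin m
    turn t h = if t h then αf M h else h

    tourStep-turn : ∀ t h → tourStep M t h ≡ σf M (turn t h)
    tourStep-turn t h with t h
    ... | true  = refl
    ... | false = refl

    turn-involutive : ∀ {t} → AlphaClosed t → ∀ h → turn t (turn t h) ≡ h
    turn-involutive {t} closed h with t h in th
    ... | true  rewrite closed h | th = α-involutive h
    ... | false rewrite th = refl

  tourStep-injective : ∀ {t} → AlphaClosed t → Injective _≡_ _≡_ (tourStep M t)
  tourStep-injective {t} closed {a} {b} e = begin
    a                     ≡⟨ turn-involutive closed a ⟨
    turn t (turn t a)     ≡⟨ cong (turn t) (σ-injective (begin
                               σf M (turn t a)  ≡⟨ tourStep-turn t a ⟨
                               tourStep M t a   ≡⟨ e ⟩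
                               tourStep M t b   ≡⟨ tourStep-turn t b ⟩
                               σf M (turn t b)  ∎)) ⟩
    turn t (turn t b)     ≡⟨ turn-involutive closed b ⟩
    b                     ∎
    where open ≡-Reasoning

  InTour : (Fin m → Bool) → Fin m → Set
  InTour t = Reach (tourStep M t) (root M)

  tourStep-agree : ∀ {t t′ h} → t h ≡ t′ h ⊎ h ≡ root M → tourStep M t h ≡ tourStep M t′ h
  tourStep-agree {h = h} (inj₁ th≡t′h) = cong (λ b → if b then σf M (αf M h) else σf M h) th≡t′h
  tourStep-agree {t} {t′} (inj₂ refl)  = trans (tourStep-root t) (sym (tourStep-root t′))

  addEdge : (Fin m → Bool) → Fin m → Fin m → Bool
  addEdge t x = update (update t x true) (αf M x) true

  addEdge-x : ∀ t x → addEdge t x x ≡ true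
  addEdge-x t x with x ≟ αf M x
  ... | yes _ = refl
  ... | no _  = update-≡ t x true

  addEdge-αx : ∀ t x → addEdge t x (αf M x) ≡ true
  addEdge-αx t x = update-≡ (update t x true) (αf M x) true

  addEdge-other : ∀ t {x h} → h ≢ x → h ≢ αf M x → addEdge t x h ≡ t h
  addEdge-other t {x} h≢x h≢αx = trans (update-≢ (update t x true) true h≢αx) (update-≢ t true h≢x)

module Growth {m} (M : RootedMap m) (T : SpanningTree M) (O : Orientation M) where
  open Tours M

  private
    r : Fin m
    r = root M

  tour? : ∀ {t} → AlphaClosed t → Decidable (InTour t)
  tour? closed = Cycles.reach? (tourStep-injective closed) r

  verticesMet : ∀ t → AlphaClosed t → ℕ
  verticesMet t closed = Cycles.cyclesMeeting σ-injective (InTour t) (tour? closed)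

  -- A subtree of T containing the root vertex; its vertices are the σ-cycles met by its tour,
  -- so half-edge-count says E = V − 1.
  record Subtree (t : Fin m → Bool) : Set where
    field
      ⊆T              : ∀ h → t h ≡ true → inT T h ≡ true
      α-closed        : AlphaClosed t
      ⊆tour           : ∀ h → t h ≡ true → InTour t h
      σ-closed        : ∀ h → InTour t h → InTour t (σf M h)
      tails-first     : ∀ y → t y ≡ true → head O y ≡ false → Before (tourStep M t) r y (αf M y)
      half-edge-count : countTrue t + 2 ≡ 2 * verticesMet t α-closed

  empty : Subtree (λ _ → false)
  empty = record
    { ⊆T = λ _ ()
    ; α-closed = λ _ → refl
    ; ⊆tour = λ _ ()
    ; σ-closed = λ _ → reach-step
    ; tails-first = λ _ ()
    ; half-edge-count = trans (cong (_+ 2) (countTrue-false {m} (λ _ → refl))) (cong (2 *_) (sym one-vertex))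
    }
    where
      none : Decidable {A = Fin m} (λ _ → ⊥)
      none _ = no (λ ())
      one-vertex : verticesMet (λ _ → false) (λ _ → refl) ≡ 1
      one-vertex = trans
        (Cycles.cyclesMeeting-∪ σ-injective none (tour? {λ _ → false} (λ _ → refl)) r
                                (λ _ → inj₂) (λ _ ()) (λ _ r↝h → r↝h) (λ _ _ ()))
        (cong suc (Cycles.cyclesMeeting-∅ σ-injective none (λ _ ())))

  module Extend {t} (S : Subtree t) {x} (x∈tour : InTour t x) (αx∉tour : ¬ InTour t (αf M x))
                (x∈T : inT T x ≡ true) (x-tail : head O x ≡ false) where
    open Subtree S

    private
      y : Fin m
      y = αf M x
      t′ : Fin m → Bool
      t′ = addEdge t x
      f g : Fin m → Fin m
      f = tourStep M t
      g = tourStep M t′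
      f-inj : Injective _≡_ _≡_ f
      f-inj = tourStep-injective α-closed

    open Cycles f-inj using (reach-sym)

    private
      x≢r : x ≢ r
      x≢r x≡r = contradiction (trans (sym x∈T) (trans (cong (inT T) x≡r) (inT-root T))) λ ()

      x≢y : x ≢ y
      x≢y e = x≢r (α-fix M x (sym e))

      t-off-tour : ∀ {h} → ¬ InTour t h → t h ≡ false
      t-off-tour {h} h∉ with t h in th
      ... | true  = ⊥-elim (h∉ (⊆tour h th))
      ... | false = refl

      t-y : t y ≡ false
      t-y = t-off-tour αx∉tour

      t-x : t x ≡ false
      t-x = trans (cong t (sym (α-involutive x))) (trans (α-closed y) t-y)

      t′-x : t′ x ≡ true
      t′-x = addEdge-x t x

      t′-y : t′ y ≡ true
      t′-y = addEdge-αx t x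

      t′-other : ∀ {h} → h ≢ x → h ≢ y → t′ h ≡ t h
      t′-other = addEdge-other t

      step-if : ∀ {b h} → b ≡ true → (if b then σf M (αf M h) else σf M h) ≡ σf M (αf M h)
      step-if refl = refl

      step-else : ∀ {b h} → b ≡ false → (if b then σf M (αf M h) else σf M h) ≡ σf M h
      step-else refl = refl

      g-x : g x ≡ f y
      g-x = trans (step-if t′-x) (sym (step-else t-y))

      g-y : g y ≡ f x
      g-y = trans (step-if t′-y) (trans (cong (σf M) (α-involutive x)) (sym (step-else t-x)))

      g-f : ∀ h → h ≢ x → h ≢ y → g h ≡ f h
      g-f h h≢x h≢y = tourStep-agree {t′} {t} (inj₁ (t′-other h≢x h≢y))

      x-y-or-other : ∀ h → h ≡ x ⊎ h ≡ y ⊎ (h ≢ x × h ≢ y)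
      x-y-or-other h with h ≟ x | h ≟ y
      ... | yes h≡x | _       = inj₁ h≡x
      ... | no _    | yes h≡y = inj₂ (inj₁ h≡y)
      ... | no h≢x  | no h≢y  = inj₂ (inj₂ (h≢x , h≢y))

      off-tour : ∀ {h} → Reach f y h → ¬ InTour t h
      off-tour y↝h r↝h = αx∉tour (reach-trans r↝h (reach-sym y↝h))

      disjoint : ∀ i j → iter f i r ≢ iter f j y
      disjoint i j e = off-tour (j , refl) (i , e)

      f-on-new-vertex : ∀ {h} → Reach f y h → f h ≡ σf M h
      f-on-new-vertex y↝h = step-else (t-off-tour (off-tour y↝h))

      new-vertex : ∀ k → iter f k y ≡ iter (σf M) k y
      new-vertex = iter-cong (λ k → f-on-new-vertex (k , refl))

      new-vertex⁺ : ∀ {h} → Reach f y h → Reach (σf M) y h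
      new-vertex⁺ (k , e) = k , trans (sym (new-vertex k)) e

      new-vertex⁻ : ∀ {h} → Reach (σf M) y h → Reach f y h
      new-vertex⁻ (k , e) = k , trans (new-vertex k) e

    open Cycles.Merge f-inj g-x g-y g-f x∈tour disjoint

    countTrue-addEdge : countTrue t′ ≡ suc (suc (countTrue t))
    countTrue-addEdge = trans
      (countTrue-insert {p = update t x true} y (trans (update-≢ t true (x≢y ∘ sym)) t-y) t′-y
                        (λ h h≢y → sym (update-≢ (update t x true) true h≢y)))
      (cong suc (countTrue-insert x t-x (update-≡ t x true) (λ h h≢x → sym (update-≢ t true h≢x))))

    private
      ⊆T′ : ∀ h → t′ h ≡ true → inT T h ≡ true
      ⊆T′ h t′h with x-y-or-other h
      ... | inj₁ refl                  = x∈T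
      ... | inj₂ (inj₁ refl)           = trans (inT-α T x) x∈T
      ... | inj₂ (inj₂ (h≢x , h≢y))    = ⊆T h (trans (sym (t′-other h≢x h≢y)) t′h)

      α-closed′ : AlphaClosed t′
      α-closed′ h with x-y-or-other h
      ... | inj₁ refl                  = trans t′-y (sym t′-x)
      ... | inj₂ (inj₁ refl)           = trans (cong t′ (α-involutive x)) (trans t′-x (sym t′-y))
      ... | inj₂ (inj₂ (h≢x , h≢y))    =
        trans (t′-other αh≢x αh≢y) (trans (α-closed h) (sym (t′-other h≢x h≢y)))
        where
          αh≢x : αf M h ≢ x
          αh≢x e = h≢y (trans (sym (α-involutive h)) (cong (αf M) e))
          αh≢y : αf M h ≢ y
          αh≢y e = h≢x (α-injective e)

      ⊆tour′ : ∀ h → t′ h ≡ true → InTour t′ h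
      ⊆tour′ h t′h with x-y-or-other h
      ... | inj₁ refl                  = reach-merged⁻ (inj₁ x∈tour)
      ... | inj₂ (inj₁ refl)           = reach-merged⁻ (inj₂ (0 , refl))
      ... | inj₂ (inj₂ (h≢x , h≢y))    =
        reach-merged⁻ (inj₁ (⊆tour h (trans (sym (t′-other h≢x h≢y)) t′h)))

      σ-closed′ : ∀ h → InTour t′ h → InTour t′ (σf M h)
      σ-closed′ h r↝h with reach-merged r↝h
      ... | inj₁ old = reach-merged⁻ (inj₁ (σ-closed h old))
      ... | inj₂ new = reach-merged⁻ (inj₂ (subst (Reach f y) (f-on-new-vertex new) (reach-step new)))

      tails-first′ : ∀ u → t′ u ≡ true → head O u ≡ false → Before g r u (αf M u)
      tails-first′ u t′u u-tail with x-y-or-other u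
      ... | inj₁ refl                  = x-before-y
      ... | inj₂ (inj₁ refl)           = contradiction (trans (sym y-head) u-tail) λ ()
        where
          y-head : head O y ≡ true
          y-head = trans (head-α O x x≢r) (cong not x-tail)
      ... | inj₂ (inj₂ (u≢x , u≢y))    =
        before-merged (tails-first u tu u-tail)
                      (λ y↝αu → off-tour y↝αu (⊆tour (αf M u) (trans (α-closed u) tu)))
        where
          tu : t u ≡ true
          tu = trans (sym (t′-other u≢x u≢y)) t′u

      vertices′ : verticesMet t′ α-closed′ ≡ suc (verticesMet t α-closed)
      vertices′ = Cycles.cyclesMeeting-∪ σ-injective _ _ y
        (λ h r↝h → map₂ new-vertex⁺ (reach-merged r↝h))
        (λ h → reach-merged⁻ ∘ inj₁) (λ h → reach-merged⁻ ∘ inj₂ ∘ new-vertex⁻)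
        (λ h → off-tour ∘ new-vertex⁻)

      half-edge-count′ : countTrue t′ + 2 ≡ 2 * verticesMet t′ α-closed′
      half-edge-count′ = begin
        countTrue t′ + 2                  ≡⟨ cong (_+ 2) countTrue-addEdge ⟩
        suc (suc (countTrue t + 2))       ≡⟨ cong (suc ∘ suc) half-edge-count ⟩
        2 + 2 * verticesMet t α-closed    ≡⟨ *-suc 2 (verticesMet t α-closed) ⟨
        2 * suc (verticesMet t α-closed)  ≡⟨ cong (2 *_) vertices′ ⟨
        2 * verticesMet t′ α-closed′      ∎
        where open ≡-Reasoning

    subtree : Subtree t′
    subtree = record
      { ⊆T = ⊆T′ ; α-closed = α-closed′ ; ⊆tour = ⊆tour′ ; σ-closed = σ-closed′
      ; tails-first = tails-first′ ; half-edge-count = half-edge-count′ }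

  Maximal : (Fin m → Bool) → Set
  Maximal t = ∀ x → InTour t x → inT T x ≡ true → head O x ≡ false → InTour t (αf M x)

  private
    Extension : (Fin m → Bool) → Fin m → Set
    Extension t x = InTour t x × ¬ InTour t (αf M x) × inT T x ≡ true × head O x ≡ false

    extension? : ∀ {t} → AlphaClosed t → Decidable (Extension t)
    extension? closed x =
      tour? closed x ×-dec ¬? (tour? closed (αf M x)) ×-dec
      (inT T x Bool.≟ true) ×-dec (head O x Bool.≟ false)

  grow : ∀ fuel {t} → Subtree t → countTrue (inT T) < countTrue t + fuel →
         Σ (Fin m → Bool) λ t′ → Subtree t′ × Maximal t′
  grow zero S lt = ⊥-elim (<⇒≱ (subst (_ <_) (+-identityʳ _) lt) (countTrue-mono (Subtree.⊆T S)))
  grow (suc fuel) {t} S lt with any? (extension? (Subtree.α-closed S))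
  ... | yes (x , x∈tour , αx∉tour , x∈T , x-tail) =
    grow fuel E.subtree
      (subst (λ n → countTrue (inT T) < n + fuel) (sym E.countTrue-addEdge)
             (<-≤-trans lt (≤-trans (≤-reflexive (+-suc (countTrue t) fuel)) (n≤1+n _))))
    where module E = Extend S x∈tour αx∉tour x∈T x-tail
  ... | no no-extension = t , S , λ x x∈tour x∈T x-tail →
    decidable-stable (tour? (Subtree.α-closed S) (αf M x))
                     (λ αx∉tour → no-extension (x , x∈tour , αx∉tour , x∈T , x-tail))

  opaque
    maximal-subtree : Σ (Fin m → Bool) λ t → Subtree t × Maximal t
    maximal-subtree = grow (suc (countTrue (inT T))) empty
      (subst (λ n → countTrue (inT T) < n + suc (countTrue (inT T)))
             (sym (countTrue-false {m} (λ _ → refl))) (n<1+n _))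

  maximal-covers : IsDelta M T O → ∀ {t} → Subtree t → Maximal t → ∀ h → InTour t h
  maximal-covers D {t} S maximal h =
    fold (λ a b → InTour t a → InTour t b) (λ step rest → rest ∘ preserves step) (λ a∈ → a∈)
         (IsDelta.tree-away D h) (0 , refl)
    where
      preserves : ∀ {a b} → b ≡ σf M a ⊎ (inT T a ≡ true × head O a ≡ false × b ≡ αf M a) →
                  InTour t a → InTour t b
      preserves (inj₁ refl)                   = Subtree.σ-closed S _
      preserves (inj₂ (a∈T , a-tail , refl)) = λ a∈ → maximal _ a∈ a∈T a-tail

  spanning-subtree : ∀ {t} → Subtree t → (∀ h → InTour t h) → ∀ h → t h ≡ inT T h
  spanning-subtree {t} S covers = countTrue-⊆-≡ ⊆T (+-cancelʳ-≡ 2 _ _ (begin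
    countTrue t + 2                ≡⟨ half-edge-count ⟩
    2 * verticesMet t α-closed     ≡⟨ cong (2 *_) (Cycles.cyclesMeeting-all σ-injective _ covers) ⟩
    2 * V M                        ≡⟨ edgeCount T ⟨
    countTrue (inT T) + 2          ∎))
    where
      open Subtree S
      open ≡-Reasoning

  module _ (D : IsDelta M T O) where
    private
      t : Fin m → Bool
      t = proj₁ maximal-subtree
      S : Subtree t
      S = proj₁ (proj₂ maximal-subtree)
      covers : ∀ h → InTour t h
      covers = maximal-covers D S (proj₂ (proj₂ maximal-subtree))
      same-iter : ∀ k → iter (tourStep M t) k r ≡ iter (tourStep M (inT T)) k r
      same-iter = iter-cong (λ k → tourStep-agree {t} {inT T} (inj₁ (spanning-subtree S covers _)))

    treeTour-covers : ∀ h → Reach (tourStep M (inT T)) r h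
    treeTour-covers h with covers h
    ... | k , e = k , trans (sym (same-iter k)) e

    treeTour-tails-first : ∀ y → inT T y ≡ true → head O y ≡ false → Precedes M T y (αf M y)
    treeTour-tails-first y y∈T y-tail
      with Subtree.tails-first S y (trans (spanning-subtree S covers y) y∈T) y-tail
    ... | k , e , later =
      k , trans (sym (same-iter k)) e , λ j j≤k e′ → later j j≤k (trans (same-iter j) e′)

module Simulation {m} (M : RootedMap m) (T : SpanningTree M) (O : Orientation M) (D : IsDelta M T O) where
  open Tours M
  open Growth M T O using (treeTour-covers; treeTour-tails-first)

  private
    r : Fin m
    r = root M
    P : Fin m → Fin m
    P = tourStep M (inT T)

  open Cycles (tourStep-injective {inT T} (inT-α T)) using (Cycle; cycle; module CycleProperties)

  private
    C : Cycle r
    C = cycle r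
    p : ℕ
    p = Cycle.length C

  tour : ℕ → Fin m
  tour k = iter P k r

  encountered : ℕ → Fin m → Bool
  encountered zero    = λ _ → false
  encountered (suc k) = update (encountered k) (tour k) true

  encountered-sound : ∀ k {z} → encountered k z ≡ true → Σ ℕ λ j → j < k × tour j ≡ z
  encountered-sound (suc k) {z} e with z ≟ tour k
  ... | yes z≡ = k , ≤-refl , sym z≡
  ... | no _ with encountered-sound k e
  ...   | j , j<k , tj≡z = j , m≤n⇒m≤1+n j<k , tj≡z

  encountered-complete : ∀ {j k} → j < k → encountered k (tour j) ≡ true
  encountered-complete {j} {suc k} j<sk with tour j ≟ tour k
  ... | yes _ = refl
  ... | no tj≢tk with m≤n⇒m<n∨m≡n (≤-pred j<sk)
  ...   | inj₁ j<k  = encountered-complete j<k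
  ...   | inj₂ refl = ⊥-elim (tj≢tk refl)

  tail : Fin m → Fin m
  tail z = if head O z then αf M z else z

  private
    tail-≢r : ∀ {h} → head O h ≡ false → h ≢ r
    tail-≢r h-tail refl = contradiction (trans (sym h-tail) (head-root O)) λ ()

    tree-≢r : ∀ {h} → inT T h ≡ true → h ≢ r
    tree-≢r h∈T refl = contradiction (trans (sym h∈T) (inT-root T)) λ ()

    α-≢r : ∀ {h} → h ≢ r → αf M h ≢ r
    α-≢r h≢r αh≡r = h≢r (trans (sym (α-involutive _)) (trans (cong (αf M) αh≡r) (α-root M)))

    head-opposite : ∀ {h b} → h ≢ r → head O h ≡ b → head O (αf M h) ≡ not b
    head-opposite h≢r refl = head-α O _ h≢r

  tail-of-tail : ∀ {z} → head O z ≡ false → tail z ≡ z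
  tail-of-tail {z} hz = cong (λ b → if b then αf M z else z) hz

  tail-of-head : ∀ {z} → head O z ≡ true → tail z ≡ αf M z
  tail-of-head {z} hz = cong (λ b → if b then αf M z else z) hz

  tail-inverse : ∀ {z h} → z ≢ r → tail z ≡ h → head O h ≡ false × (z ≡ h ⊎ z ≡ αf M h)
  tail-inverse {z} z≢r tz≡h with head O z in hz
  ... | false = trans (cong (head O) (sym tz≡h)) hz , inj₁ tz≡h
  ... | true  = trans (cong (head O) (sym tz≡h)) (head-opposite z≢r hz) ,
                inj₂ (trans (sym (α-involutive z)) (cong (αf M) tz≡h))

  encountered-before : ∀ {k u v} → Before P r u v → tour k ≡ v → encountered k u ≡ true
  encountered-before {k} (k′ , tk′≡u , v-later) tk≡v with k′ <? k
  ... | yes k′<k = subst (λ z → encountered k z ≡ true) tk′≡u (encountered-complete k′<k)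
  ... | no k′≮k  = ⊥-elim (v-later k (≮⇒≥ k′≮k) tk≡v)

  unencountered-after : ∀ {k u v} → k < p → Before P r u v → tour k ≡ u → encountered k v ≡ false
  unencountered-after {k} {u} {v} k<p u-first tk≡u with encountered k v in met
  ... | false = refl
  ... | true with encountered-sound k met | CycleProperties.before-within C u-first
  ...   | j , j<k , tj≡v | k′ , k′<p , tk′≡u , v-later =
    ⊥-elim (v-later j (≤-trans (<⇒≤ j<k) (≤-reflexive k≡k′)) tj≡v)
    where
      k≡k′ : k ≡ k′
      k≡k′ = CycleProperties.distinct C k<p k′<p (trans tk≡u (sym tk′≡u))

  nontree-tail-met-head : ∀ k → inT T (tour k) ≡ false → head O (tour k) ≡ false →
                          encountered k (αf M (tour k)) ≡ true
  nontree-tail-met-head k h∉T h-tail = encountered-before {k}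
    (proj₁ (IsDelta.nontree D (αf M (tour k)) (α-≢r (tail-≢r h-tail)) (trans (inT-α T _) h∉T))
           (head-opposite (tail-≢r h-tail) h-tail))
    (sym (α-involutive _))

  tree-tail-unmet-head : ∀ {k} → k < p → inT T (tour k) ≡ true → head O (tour k) ≡ false →
                         encountered k (αf M (tour k)) ≡ false
  tree-tail-unmet-head k<p h∈T h-tail = unencountered-after k<p (treeTour-tails-first D _ h∈T h-tail) refl

  tree-head-met-tail : ∀ k → inT T (tour k) ≡ true → head O (tour k) ≡ true →
                       encountered k (αf M (tour k)) ≡ true
  tree-head-met-tail k h∈T h-head = encountered-before {k}
    (treeTour-tails-first D _ (trans (inT-α T _) h∈T) (head-opposite (tree-≢r h∈T) h-head))
    (sym (α-involutive _))

  data Kind (h : Fin m) : Set where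
    tree-tail : inT T h ≡ true  → head O h ≡ false → Kind h
    tree-head : inT T h ≡ true  → head O h ≡ true  → Kind h
    nontree   : inT T h ≡ false → Kind h

  kind : ∀ h → Kind h
  kind h with inT T h in h∈T | head O h in hh
  ... | true  | false = tree-tail h∈T hh
  ... | true  | true  = tree-head h∈T hh
  ... | false | _     = nontree h∈T

  -- γ's tree is left unconstrained at the root: a leg fixed by α, where both branches of a tour
  -- step coincide (tourStep-root).
  record Simulates (k : ℕ) (s : GState m) : Set where
    field
      at-tour : GState.cur s ≡ tour k
      enc-met : ∀ z → GState.enc s z ≡ encountered k z
      tr-tree : ∀ z → z ≢ r → GState.tr s z ≡ inT T z ∧ encountered k (tail z)

  module Step {k} (k<p : k < p) {t e : Fin m → Bool}
              (e≗ : ∀ z → e z ≡ encountered k z)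
              (t≗ : ∀ z → z ≢ r → t z ≡ inT T z ∧ encountered k (tail z)) where

    private
      h : Fin m
      h = tour k

      added : Bool
      added = not (head O h) ∧ not (e (αf M h))

    t′ : Fin m → Bool
    t′ = if added then addEdge t h else t

    private
      added-tree-tail : inT T h ≡ true → head O h ≡ false → added ≡ true
      added-tree-tail h∈T h-tail =
        cong₂ (λ a b → not a ∧ not b) h-tail (trans (e≗ _) (tree-tail-unmet-head k<p h∈T h-tail))

      added-head : head O h ≡ true → added ≡ false
      added-head h-head = cong (λ a → not a ∧ not (e (αf M h))) h-head

      added-nontree : inT T h ≡ false → added ≡ false
      added-nontree h∉T with head O h in hh
      ... | true  = refl
      ... | false = cong not (trans (e≗ _) (nontree-tail-met-head k h∉T hh))

      t′-added : added ≡ true → ∀ z → t′ z ≡ addEdge t h z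
      t′-added a z = cong (λ b → (if b then addEdge t h else t) z) a

      t′-unchanged : added ≡ false → ∀ z → t′ z ≡ t z
      t′-unchanged a z = cong (λ b → (if b then addEdge t h else t) z) a

    next : tourStep M t′ h ≡ tour (suc k)
    next = tourStep-agree {t′} {inT T} agree
      where
        agree : t′ h ≡ inT T h ⊎ h ≡ r
        agree with kind h
        ... | tree-tail h∈T h-tail = inj₁ (trans (t′-added (added-tree-tail h∈T h-tail) h)
                                                 (trans (addEdge-x t h) (sym h∈T)))
        ... | tree-head h∈T h-head = inj₁ (begin
          t′ h                                    ≡⟨ t′-unchanged (added-head h-head) h ⟩
          t h                                     ≡⟨ t≗ h (tree-≢r h∈T) ⟩
          inT T h ∧ encountered k (tail h)        ≡⟨ cong (λ z → inT T h ∧ encountered k z) (tail-of-head h-head) ⟩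
          inT T h ∧ encountered k (αf M h)        ≡⟨ cong (inT T h ∧_) (tree-head-met-tail k h∈T h-head) ⟩
          inT T h ∧ true                          ≡⟨ ∧-identityʳ _ ⟩
          inT T h                                 ∎)
          where open ≡-Reasoning
        ... | nontree h∉T with h ≟ r
        ...   | yes h≡r = inj₂ h≡r
        ...   | no h≢r  = inj₁ (trans (t′-unchanged (added-nontree h∉T) h)
                                      (trans (t≗ h h≢r)
                                             (trans (cong (_∧ encountered k (tail h)) h∉T) (sym h∉T))))

    private
      t′-on-new-edge : ∀ {z} → z ≢ r → tail z ≡ h → t′ z ≡ inT T z
      t′-on-new-edge {z} z≢r tz≡h = on-edge (kind h)
        where
          h-tail : head O h ≡ false
          h-tail = proj₁ (tail-inverse z≢r tz≡h)
          z-on-edge : z ≡ h ⊎ z ≡ αf M h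
          z-on-edge = proj₂ (tail-inverse z≢r tz≡h)
          same-edge : inT T z ≡ inT T h
          same-edge = [ cong (inT T) , (λ z≡αh → trans (cong (inT T) z≡αh) (inT-α T h)) ]′ z-on-edge
          on-edge : Kind h → t′ z ≡ inT T z
          on-edge (tree-tail h∈T _) = trans (t′-added (added-tree-tail h∈T h-tail) z)
            (trans ([ (λ { refl → addEdge-x t h }) , (λ { refl → addEdge-αx t h }) ]′ z-on-edge)
                   (sym (trans same-edge h∈T)))
          on-edge (tree-head _ h-head) = contradiction (trans (sym h-head) h-tail) λ ()
          on-edge (nontree h∉T) = trans (t′-unchanged (added-nontree h∉T) z)
            (trans (t≗ z z≢r) (trans (cong (_∧ encountered k (tail z)) z∉T) (sym z∉T)))
            where
              z∉T : inT T z ≡ false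
              z∉T = trans same-edge h∉T

      t′-off-new-edge : ∀ {z} → tail z ≢ h → t′ z ≡ t z
      t′-off-new-edge {z} tz≢h with kind h
      ... | tree-tail h∈T h-tail = trans (t′-added (added-tree-tail h∈T h-tail) z)
        (addEdge-other t (λ z≡h → tz≢h (trans (cong tail z≡h) (tail-of-tail h-tail)))
                         (λ z≡αh → tz≢h (trans (cong tail z≡αh)
                                          (trans (tail-of-head (head-opposite {h} (tail-≢r h-tail) h-tail))
                                                 (α-involutive h)))))
      ... | tree-head _ h-head = t′-unchanged (added-head h-head) z
      ... | nontree h∉T        = t′-unchanged (added-nontree h∉T) z

    t′-invariant : ∀ z → z ≢ r → t′ z ≡ inT T z ∧ encountered (suc k) (tail z)
    t′-invariant z z≢r = by-cases (tail z ≟ h)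
      where
        open ≡-Reasoning
        by-cases : Dec (tail z ≡ h) → t′ z ≡ inT T z ∧ encountered (suc k) (tail z)
        by-cases (yes tz≡h) = begin
          t′ z                                   ≡⟨ t′-on-new-edge z≢r tz≡h ⟩
          inT T z                                ≡⟨ ∧-identityʳ _ ⟨
          inT T z ∧ true                         ≡⟨ cong (inT T z ∧_) (update-≡ (encountered k) h true) ⟨
          inT T z ∧ encountered (suc k) h        ≡⟨ cong (λ w → inT T z ∧ encountered (suc k) w) tz≡h ⟨
          inT T z ∧ encountered (suc k) (tail z) ∎
        by-cases (no tz≢h) = begin
          t′ z                                   ≡⟨ t′-off-new-edge tz≢h ⟩
          t z                                    ≡⟨ t≗ z z≢r ⟩
          inT T z ∧ encountered k (tail z)       ≡⟨ cong (inT T z ∧_) (update-≢ (encountered k) true tz≢h) ⟨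
          inT T z ∧ encountered (suc k) (tail z) ∎

  simulates-step : ∀ {k s} → k < p → Simulates k s → Simulates (suc k) (γstep M O s)
  simulates-step {k} {gstate h t e} k<p sim with Simulates.at-tour sim
  ... | refl = record
    { at-tour = next
    ; enc-met = λ z → cong (λ b → if ⌊ z ≟ tour k ⌋ then true else b) (Simulates.enc-met sim z)
    ; tr-tree = t′-invariant }
    where open Step k<p (Simulates.enc-met sim) (Simulates.tr-tree sim)

  initial : GState m
  initial = gstate r (λ h → ⌊ h ≟ r ⌋) (λ _ → false)

  simulates-initial : Simulates 0 initial
  simulates-initial = record
    { at-tour = refl
    ; enc-met = λ _ → refl
    ; tr-tree = λ z z≢r → trans (isYes-false (z ≟ r) z≢r) (sym (∧-zeroʳ (inT T z))) }

  γrun-completes : ∀ n k s → Simulates k s → k < p → p ≤ k + n →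
                   Σ (GState m) λ s′ → Simulates p s′ × γrun M O n s ≡ just (GState.tr s′)
  γrun-completes zero    k s _   k<p p≤k+0 = ⊥-elim (<⇒≱ k<p (subst (p ≤_) (+-identityʳ k) p≤k+0))
  γrun-completes (suc n) k s sim k<p p≤k+n = continue (suc k ℕ.≟ p)
    where
      s′ : GState m
      s′ = γstep M O s

      sim′ : Simulates (suc k) s′
      sim′ = simulates-step k<p sim

      stops-if : ∀ {b} → ⌊ GState.cur s′ ≟ r ⌋ ≡ b →
                 γrun M O (suc n) s ≡ (if b then just (GState.tr s′) else γrun M O n s′)
      stops-if = cong (λ b → if b then just (GState.tr s′) else γrun M O n s′)

      continue : Dec (suc k ≡ p) →
                 Σ (GState m) λ s″ → Simulates p s″ × γrun M O (suc n) s ≡ just (GState.tr s″)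
      continue (yes sk≡p) = s′ , subst (λ j → Simulates j s′) sk≡p sim′ , stops-if (isYes-true (GState.cur s′ ≟ r)
        (trans (Simulates.at-tour sim′) (trans (cong tour sk≡p) (Cycle.returns C))))
      continue (no sk≢p) with γrun-completes n (suc k) s′ sim′ sk<p (subst (p ≤_) (+-suc k n) p≤k+n)
        where
          sk<p : suc k < p
          sk<p = ≤∧≢⇒< k<p sk≢p
      ... | s″ , sim″ , γ≡ = s″ , sim″ , trans (stops-if (isYes-false (GState.cur s′ ≟ r) not-back)) γ≡
        where
          not-back : GState.cur s′ ≢ r
          not-back e =
            Cycle.minimal C (suc k) (s≤s z≤n) (≤∧≢⇒< k<p sk≢p) (trans (sym (Simulates.at-tour sim′)) e)

  γ-returns-tree : Σ (Fin m → Bool) λ T′ → γ M O ≡ just T′ × (∀ h → h ≢ r → T′ h ≡ inT T h)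
  γ-returns-tree
    with γrun-completes m 0 initial simulates-initial (Cycle.length>0 C) (CycleProperties.length≤m C)
  ... | s , sim , γ≡ = GState.tr s , γ≡ , λ z z≢r → begin
    GState.tr s z                      ≡⟨ Simulates.tr-tree sim z z≢r ⟩
    inT T z ∧ encountered p (tail z)   ≡⟨ cong (inT T z ∧_) (all-met (tail z)) ⟩
    inT T z ∧ true                     ≡⟨ ∧-identityʳ _ ⟩
    inT T z                            ∎
    where
      open ≡-Reasoning
      all-met : ∀ w → encountered p w ≡ true
      all-met w with CycleProperties.within C (treeTour-covers D w)
      ... | j , j<p , refl = encountered-complete j<p

lemma4 : ∀ {m} (M : RootedMap m) (T : SpanningTree M) (O : Orientation M) →
    IsDelta M T O →
    Σ (Fin m → Bool) λ T' → (γ M O ≡ just T') × (∀ h → ¬ (h ≡ root M) → T' h ≡ inT T h)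
lemma4 M T O D = Simulation.γ-returns-tree M T O D
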